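{- There exists an infinite family of instances, each consisting of a graph $G=(V,E)$ with given clockwise edge orders and a set $L$ of lines, such that every consistent solution has $\Omega(|L|\sqrt{|E'|})$ block crossings in total, where $E'$ is the set of edges used by at least two lines.
   Context: An instance consists of a graph $G=(V,E)$ with a fixed clockwise order of incident edges around each vertex, and a set $L$ of lines, each a simple path in $G$, such that every line has both endpoints at vertices of degree one and no two lines share an endpoint, and the intersection of any two lines is empty or a path. For an edge $e=(u,v)$ let $L_e$ be the set of lines using $e$. A block move exchanges two adjacent consecutive blocks of a sequence. A solution assigns to each edge $e=(u,v)$ a sequence of orderings $\pi^0(e),\dots,\pi^{t(e)}(e)$ of $L_e$ (from near $u$ to near $v$), each obtained from the previous by one block move; $t(e)$ is the number of block crossings on $e$ and the total is $\sum_e t(e)$. It is consistent if at every vertex the orders on the incident edges, combined according to the clockwise edge order, create no crossing at the vertex between two lines sharing an edge. -}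

module Defs where

open import Data.Nat using (ℕ; zero; suc; _+_; _*_; _∸_; _^_; _≤_; _<_; _≤ᵇ_)
open import Data.Fin as F using (Fin)
open import Data.Fin.Properties using () renaming (_≟_ to _≟F_)
open import Data.Bool using (Bool; true; false; _∧_; _∨_; if_then_else_)
open import Data.List using (List; []; _∷_; _++_; length; filterᵇ; allFin; concatMap; reverse; map; cartesianProduct)
open import Data.List.Membership.Propositional using (_∈_)
open import Data.List.Relation.Unary.Unique.Propositional using (Unique)
open import Data.List.Relation.Unary.All using (All)
open import Data.Maybe using (fromMaybe)
open import Data.Bool.ListAction using (any)
open import Data.Nat.ListAction using (sum)
import Data.List as L
open import Data.Product using (Σ; ∃; _×_; _,_; proj₁; proj₂)
open import Data.Sum using (_⊎_)
open import Relation.Binary.PropositionalEquality using (_≡_; _≢_)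
open import Relation.Nullary using (¬_)
open import Relation.Nullary.Decidable using (⌊_⌋)

Infix : {A : Set} → List A → List A → Set
Infix xs ys = ∃ λ pre → ∃ λ suf → ys ≡ pre ++ xs ++ suf

memᵇ : {n : ℕ} → Fin n → List (Fin n) → Bool
memᵇ x xs = any (λ y → ⌊ x ≟F y ⌋) xs

firstL : {A : Set} → List (List A) → List A
firstL xs = fromMaybe [] (L.head xs)

lastL : {A : Set} → List (List A) → List A
lastL xs = fromMaybe [] (L.last xs)

BlockMove : {A : Set} → List A → List A → Set
BlockMove π π′ = ∃ λ A → ∃ λ B → ∃ λ C → ∃ λ D →
  (B ≢ []) × (C ≢ []) × (π ≡ A ++ B ++ C ++ D) × (π′ ≡ A ++ C ++ B ++ D)

data BlockMoveSeq {A : Set} : List (List A) → Set where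
  single : ∀ π → BlockMoveSeq (π ∷ [])
  step   : ∀ π π′ πs → BlockMove π π′ → BlockMoveSeq (π′ ∷ πs) → BlockMoveSeq (π ∷ π′ ∷ πs)

usesᵇ : {n : ℕ} → List (Fin n) → Fin n → Fin n → Bool
usesᵇ []           u w = false
usesᵇ (x ∷ [])     u w = false
usesᵇ (x ∷ y ∷ r)  u w =
  (⌊ x ≟F u ⌋ ∧ ⌊ y ≟F w ⌋) ∨ (⌊ x ≟F w ⌋ ∧ ⌊ y ≟F u ⌋) ∨ usesᵇ (y ∷ r) u w

Uses : {n : ℕ} → List (Fin n) → Fin n → Fin n → Set
Uses p u w = usesᵇ p u w ≡ true

data Consecutive {n : ℕ} (R : Fin n → Fin n → Set) : List (Fin n) → Set where
  nil  : Consecutive R []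
  one  : ∀ x → Consecutive R (x ∷ [])
  cons : ∀ x y r → R x y → Consecutive R (y ∷ r) → Consecutive R (x ∷ y ∷ r)

firstV : {n : ℕ} → List (Fin n) → List (Fin n)
firstV []      = []
firstV (x ∷ _) = x ∷ []

lastV : {n : ℕ} → List (Fin n) → List (Fin n)
lastV xs = firstV (reverse xs)

endpoints : {n : ℕ} → List (Fin n) → List (Fin n)
endpoints p = firstV p ++ lastV p

-- The embedded graph is given by a rotation system:
-- rot v is the list of neighbours of v in clockwise order (this both
-- determines the edge set and the clockwise order of incident edges).

record Instance : Set where
  field
    n    : ℕ
    rot  : Fin n → List (Fin n)
    k    : ℕ
    line : Fin k → List (Fin n)
    -- simple graph, undirected
    rot-unique : ∀ v → Unique (rot v)
    rot-noloop : ∀ v → ¬ (v ∈ rot v)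
    rot-sym    : ∀ v w → w ∈ rot v → v ∈ rot w
    line-len    : ∀ i → 2 ≤ length (line i)
    line-simple : ∀ i → Unique (line i)
    line-path   : ∀ i → Consecutive (λ x y → y ∈ rot x) (line i)
    line-ends   : ∀ i → All (λ v → length (rot v) ≡ 1) (endpoints (line i))
    line-disj   : ∀ i j → i ≢ j → ∀ v → v ∈ endpoints (line i) → ¬ (v ∈ endpoints (line j))
    -- the intersection of two lines is empty or a path: the common
    -- vertices form a contiguous block of both lines (in the same or
    -- reversed order)
    line-inter  : ∀ i j → i ≢ j →
      let c = filterᵇ (λ x → memᵇ x (line j)) (line i) in
      Infix c (line i) × (Infix c (line j) ⊎ Infix (reverse c) (line j))

module _ (I : Instance) where
  open Instance I

  -- edges, each listed once as (u , w) with u < w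
  edges : List (Fin n × Fin n)
  edges = filterᵇ (λ e → ⌊ F._<?_ (proj₁ e) (proj₂ e) ⌋ ∧ memᵇ (proj₂ e) (rot (proj₁ e)))
                  (cartesianProduct (allFin n) (allFin n))

  linesOn : Fin n → Fin n → List (Fin k)
  linesOn u w = filterᵇ (λ i → usesᵇ (line i) u w) (allFin k)

  edges′ : List (Fin n × Fin n)
  edges′ = filterᵇ (λ e → 2 ≤ᵇ length (linesOn (proj₁ e) (proj₂ e))) edges

  SharesEdge : Fin k → Fin k → Set
  SharesEdge i j = ∃ λ u → ∃ λ w → Uses (line i) u w × Uses (line j) u w

  -- A solution: for each edge (u , w) with u < w, the sequence
  -- π⁰, …, πᵗ of orderings of L_e from near u to near w.  Each ordering
  -- lists the lines left-to-right as seen when looking from u towards w.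
  Solution : Set
  Solution = Fin n → Fin n → List (List (Fin k))

  crossingsOn : Solution → Fin n → Fin n → ℕ
  crossingsOn S u w = length (S u w) ∸ 1

  total : Solution → ℕ
  total S = sum (map (λ e → crossingsOn S (proj₁ e) (proj₂ e)) edges)

  IsOrderingOf : Fin n → Fin n → List (Fin k) → Set
  IsOrderingOf u w π = Unique π × (∀ i → (i ∈ π → Uses (line i) u w) × (Uses (line i) u w → i ∈ π))

  ValidSolution : Solution → Set
  ValidSolution S = ∀ u w → (u , w) ∈ edges →
    (S u w ≢ []) × All (IsOrderingOf u w) (S u w) × BlockMoveSeq (S u w)

  -- the order of the lines on edge {v,w} at the end near v, listed
  -- left-to-right as seen when looking from v towards w
  outOrder : Solution → Fin n → Fin n → List (Fin k)
  outOrder S v w = if ⌊ F._<?_ v w ⌋ then firstL (S v w) else reverse (lastL (S w v))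

  -- all lines entering v, listed in clockwise order around v
  -- (looking outward along an edge, left is counterclockwise)
  ports : Solution → Fin n → List (Fin k)
  ports S v = concatMap (outOrder S v) (rot v)

  -- no crossing at v between two lines sharing an edge: the chords of
  -- such two lines between their ports around v do not interleave
  ConsistentAt : Solution → Fin n → Set
  ConsistentAt S v = ∀ (i j : Fin k) → i ≢ j → SharesEdge i j →
    ∀ (a₁ b₁ a₂ b₂ : Fin (length (ports S v))) →
    L.lookup (ports S v) a₁ ≡ i → L.lookup (ports S v) b₁ ≡ i →
    L.lookup (ports S v) a₂ ≡ j → L.lookup (ports S v) b₂ ≡ j →
    ¬ (a₁ F.< a₂ × a₂ F.< b₁ × b₁ F.< b₂)

  Consistent : Solution → Set
  Consistent S = ValidSolution S × (∀ v → ConsistentAt S v)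

module Submission where

-- For m = N + 1 we build the grid instance: m horizontal lines (rows) and
-- m vertical lines (columns), where row a and column b meet in a single
-- edge {NW a b , SE a b}.  The row enters NW a b from the west and leaves
-- SE a b to the east, the column enters from the north and leaves to the
-- south.  The key general fact (forced-crossing) is that two lines that
-- meet like this on an edge must swap there: if the edge carried a single
-- order, then the ports around NW a b or around SE a b would interleave
-- the two lines, violating consistency.  Hence every consistent solution
-- has t ≥ m² block crossings, one on each crossing edge.  These m² edges
-- are used by two lines, so |E′| ≥ m² ≥ N, and since the maximum degree
-- is 3 and there are at most 6m² vertices, |E′| ≤ 18 m².  With |L| = 2m:
-- |L|² |E′| ≤ 4m² · 18m² = 72 m⁴ ≤ 72 t².

open import Defs
open import Data.Nat using (ℕ; zero; suc; _+_; _*_; _∸_; _^_; _≤_; _<_; _≤ᵇ_; z≤n; s≤s)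
import Data.Nat.Properties as ℕ
open import Data.Nat.ListAction using (sum)
open import Data.Nat.Solver using (module +-*-Solver)
open +-*-Solver using (solve; _:+_; _:*_; _:^_; con; _:=_)
open import Data.Fin as F using (Fin; zero; suc; toℕ; fromℕ; inject₁; _↑ˡ_; _↑ʳ_; combine)
open import Data.Fin.Properties
  using (toℕ-injective; toℕ-inject₁; suc-injective; +↔⊎; *↔×; join-splitAt; splitAt-↑ˡ; splitAt-↑ʳ;
         toℕ-↑ˡ; toℕ-↑ʳ; toℕ<n)
  renaming (_≟_ to _≟F_)
open import Data.Bool using (Bool; true; false; _∧_; _∨_; T; T?; if_then_else_)
open import Data.Bool.Properties using (∨-zeroʳ; T-≡; T-∧)
open import Data.Maybe using (Maybe; just; nothing; maybe′)
import Data.Maybe as Maybe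
open import Data.Maybe.Properties using (just-injective)
open import Data.List
  using (List; []; _∷_; _++_; map; length; reverse; lookup; filter; filterᵇ; allFin; concatMap;
         cartesianProduct; initLast; _∷ʳ′_)
open import Data.List.Properties
  using (length-++; length-map; length-reverse; length-tabulate; length-filter; unfold-reverse; reverse-++;
         ++-assoc; ∷-injectiveˡ; map-++; filter-++; filter-none; filter-accept)
open import Data.List.Membership.Propositional using (_∈_; _∉_)
open import Data.List.Membership.Propositional.Properties
  using (∈-++⁻; ∈-++⁺ˡ; ∈-++⁺ʳ; ∈-∃++; ∈-map⁺; ∈-map⁻; ∈-filter⁺; ∈-filter⁻; ∈-cartesianProduct⁺;
         ∈-allFin; ∈-concatMap⁺)
import Data.List.Membership.DecPropositional as DecMembership
open import Data.List.Relation.Unary.Any using (here; there)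
import Data.List.Relation.Unary.Any as Any
import Data.List.Relation.Unary.Any.Properties as Anyₚ
open import Data.List.Relation.Unary.All using (All; []; _∷_)
import Data.List.Relation.Unary.All as All
open import Data.List.Relation.Unary.AllPairs using ([]; _∷_)
open import Data.List.Relation.Unary.Unique.Propositional using (Unique)
import Data.List.Relation.Unary.Unique.Propositional.Properties as Uniqueₚ
open import Data.Product using (Σ; ∃; _×_; _,_; proj₁; proj₂; uncurry)
open import Data.Product.Properties using (≡-dec)
open import Data.Sum using (_⊎_; inj₁; inj₂)
open import Data.Sum.Function.Propositional using (_⊎-↔_)
open import Data.Empty using (⊥; ⊥-elim)
open import Data.Unit using (⊤; tt)
open import Function using (_∘_; id; Equivalence)
open import Function.Bundles using (_↔_; Inverse)
open import Function.Construct.Composition using (_↔-∘_)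
open import Function.Construct.Identity using (↔-id)
open import Relation.Binary.Definitions using (tri<; tri≈; tri>; DecidableEquality)
open import Relation.Binary.PropositionalEquality
open import Relation.Nullary using (¬_; Dec; yes; no)
open import Relation.Nullary.Decidable using (⌊_⌋; isYes≗does; dec-true; dec-false)

module ListFacts {A : Set} where

  -- Pos xs i x : the element of xs at position i is x.  Positions are
  -- natural numbers so that positions in concatenations are sums.
  data Pos : List A → ℕ → A → Set where
    pos-head : ∀ x xs → Pos (x ∷ xs) 0 x
    pos-tail : ∀ {xs i x} y → Pos xs i x → Pos (y ∷ xs) (suc i) x

  ∈⇒Pos : ∀ {x xs} → x ∈ xs → ∃ λ i → Pos xs i x
  ∈⇒Pos (here refl) = 0 , pos-head _ _
  ∈⇒Pos {xs = y ∷ _} (there x∈) with ∈⇒Pos x∈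
  ... | i , p = suc i , pos-tail y p

  Pos-< : ∀ {xs i x} → Pos xs i x → i < length xs
  Pos-< (pos-head x xs) = s≤s z≤n
  Pos-< (pos-tail y p) = s≤s (Pos-< p)

  Pos-functional : ∀ {xs i x y} → Pos xs i x → Pos xs i y → x ≡ y
  Pos-functional (pos-head _ _) (pos-head _ _) = refl
  Pos-functional (pos-tail _ p) (pos-tail _ q) = Pos-functional p q

  Pos-++ˡ : ∀ {xs i x} ys → Pos xs i x → Pos (xs ++ ys) i x
  Pos-++ˡ ys (pos-head x xs) = pos-head x (xs ++ ys)
  Pos-++ˡ ys (pos-tail y p) = pos-tail y (Pos-++ˡ ys p)

  Pos-++ʳ : ∀ {ys i x} xs → Pos ys i x → Pos (xs ++ ys) (length xs + i) x
  Pos-++ʳ [] p = p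
  Pos-++ʳ (z ∷ xs) p = pos-tail z (Pos-++ʳ xs p)

  Pos-reverse : ∀ {xs i x} → Pos xs i x → Pos (reverse xs) (length xs ∸ suc i) x
  Pos-reverse (pos-head x xs) =
    subst (λ l → Pos l (length xs) x) (sym (unfold-reverse x xs))
      (subst (λ j → Pos (reverse xs ++ x ∷ []) j x)
             (trans (ℕ.+-identityʳ _) (length-reverse xs))
             (Pos-++ʳ (reverse xs) (pos-head x [])))
  Pos-reverse {y ∷ xs} (pos-tail {i = i} .y p) =
    subst (λ l → Pos l (length xs ∸ suc i) _) (sym (unfold-reverse y xs))
      (Pos-++ˡ (y ∷ []) (Pos-reverse p))

  Pos⇒lookup : ∀ {xs i x} → Pos xs i x → Σ (Fin (length xs)) λ f → lookup xs f ≡ x × toℕ f ≡ i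
  Pos⇒lookup (pos-head x xs) = zero , refl , refl
  Pos⇒lookup (pos-tail y p) with Pos⇒lookup p
  ... | f , lookup≡ , toℕ≡ = suc f , lookup≡ , cong suc toℕ≡

  ∈-insert : ∀ pre (y : A) suf {x} → x ∈ pre ++ suf → x ∈ pre ++ y ∷ suf
  ∈-insert pre y suf x∈ with ∈-++⁻ pre x∈
  ... | inj₁ x∈pre = ∈-++⁺ˡ x∈pre
  ... | inj₂ x∈suf = ∈-++⁺ʳ pre (there x∈suf)

  unique-remove : ∀ pre (y : A) suf → Unique (pre ++ y ∷ suf) →
                  Unique (pre ++ suf) × (∀ {x} → x ∈ pre ++ suf → x ≢ y)
  unique-remove [] y suf (y∉ ∷ u) = u , λ x∈ x≡y → All.lookup y∉ x∈ (sym x≡y)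
  unique-remove (z ∷ pre) y suf (z∉ ∷ u) with unique-remove pre y suf u
  ... | u′ , ≢y = (All.tabulate (λ x∈ → All.lookup z∉ (∈-insert pre y suf x∈)) ∷ u′) , ≢y′
    where
    ≢y′ : ∀ {x} → x ∈ z ∷ pre ++ suf → x ≢ y
    ≢y′ (here refl) = All.lookup z∉ (∈-++⁺ʳ pre (here refl))
    ≢y′ (there x∈) = ≢y x∈

  unique-outside : ∀ pre (u v : A) suf → Unique (pre ++ u ∷ v ∷ suf) →
                   ∀ {y} → y ∈ pre ++ suf → y ≢ u × y ≢ v
  unique-outside pre u v suf U y∈ with unique-remove pre u (v ∷ suf) U
  ... | U′ , ≢u = ≢u (∈-insert pre v suf y∈) , proj₂ (unique-remove pre v suf U′) y∈

  length-remove : ∀ pre (y : A) suf → length (pre ++ y ∷ suf) ≡ suc (length (pre ++ suf))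
  length-remove [] y suf = refl
  length-remove (x ∷ pre) y suf = cong suc (length-remove pre y suf)

  count : DecidableEquality A → (f : A → ℕ) → ∀ xs ys → Unique xs → (∀ {x} → x ∈ xs → x ∈ ys) →
          (∀ {x} → x ∈ xs → 1 ≤ f x) → length xs ≤ sum (map f ys)
  count _≟_ f [] ys _ _ _ = z≤n
  count _≟_ f (x ∷ xs) [] _ xs⊆ _ with xs⊆ (here refl)
  ... | ()
  count _≟_ f xs (y ∷ ys) u xs⊆ pos with DecMembership._∈?_ _≟_ y xs
  ... | no y∉xs = ℕ.≤-trans (count _≟_ f xs ys u xs⊆ys pos) (ℕ.m≤n+m _ (f y))
    where
    xs⊆ys : ∀ {x} → x ∈ xs → x ∈ ys
    xs⊆ys x∈ with xs⊆ x∈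
    ... | here refl = ⊥-elim (y∉xs x∈)
    ... | there x∈ys = x∈ys
  ... | yes y∈xs with ∈-∃++ y∈xs
  ...   | pre , suf , refl with unique-remove pre y suf u
  ...     | u′ , ≢y =
    subst (_≤ f y + sum (map f ys)) (sym (length-remove pre y suf))
      (ℕ.+-mono-≤ (pos (∈-++⁺ʳ pre (here refl)))
                  (count _≟_ f (pre ++ suf) ys u′ rest⊆ys (λ x∈ → pos (∈-insert pre y suf x∈))))
    where
    rest⊆ys : ∀ {x} → x ∈ pre ++ suf → x ∈ ys
    rest⊆ys x∈ with xs⊆ (∈-insert pre y suf x∈)
    ... | here refl = ⊥-elim (≢y x∈ refl)
    ... | there x∈ys = x∈ys

  unique-⊆-length : DecidableEquality A → ∀ xs ys → Unique xs → (∀ {x} → x ∈ xs → x ∈ ys) →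
                    length xs ≤ length ys
  unique-⊆-length _≟_ xs ys u xs⊆ys =
    subst (length xs ≤_) (sum-ones ys) (count _≟_ (λ _ → 1) xs ys u xs⊆ys (λ _ → ℕ.≤-refl))
    where
    sum-ones : ∀ zs → sum (map (λ _ → 1) zs) ≡ length zs
    sum-ones [] = refl
    sum-ones (_ ∷ zs) = cong suc (sum-ones zs)

  two-distinct : ∀ {x y : A} {xs} → x ∈ xs → y ∈ xs → x ≢ y → 2 ≤ length xs
  two-distinct {xs = _ ∷ _ ∷ _} _ _ _ = s≤s (s≤s z≤n)
  two-distinct {xs = _ ∷ []} (here refl) (here refl) x≢y = ⊥-elim (x≢y refl)

  sum-≤ : ∀ (f : A → ℕ) c xs → (∀ x → f x ≤ c) → sum (map f xs) ≤ c * length xs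
  sum-≤ f c [] _ = z≤n
  sum-≤ f c (x ∷ xs) f≤c =
    subst (f x + sum (map f xs) ≤_) (sym (ℕ.*-suc c (length xs))) (ℕ.+-mono-≤ (f≤c x) (sum-≤ f c xs f≤c))

length-concatMap : ∀ {A B : Set} (g : A → List B) xs → length (concatMap g xs) ≡ sum (map (λ x → length (g x)) xs)
length-concatMap g [] = refl
length-concatMap g (x ∷ xs) = trans (length-++ (g x)) (cong (length (g x) +_) (length-concatMap g xs))

length-cartesianProduct : ∀ {A B : Set} (xs : List A) (ys : List B) →
                          length (cartesianProduct xs ys) ≡ length xs * length ys
length-cartesianProduct [] ys = refl
length-cartesianProduct (x ∷ xs) ys =
  trans (length-++ (map (x ,_) ys)) (cong₂ _+_ (length-map (x ,_) ys) (length-cartesianProduct xs ys))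

open ListFacts

⌊⌋-true : ∀ {A : Set} (a? : Dec A) → A → ⌊ a? ⌋ ≡ true
⌊⌋-true a? a = trans (isYes≗does a?) (dec-true a? a)

⌊⌋-false : ∀ {A : Set} (a? : Dec A) → ¬ A → ⌊ a? ⌋ ≡ false
⌊⌋-false a? ¬a = trans (isYes≗does a?) (dec-false a? ¬a)

module Reflection {n : ℕ} where

  memᵇ-true : ∀ {x : Fin n} {ys} → x ∈ ys → memᵇ x ys ≡ true
  memᵇ-true {x} (here refl) rewrite ⌊⌋-true (x ≟F x) refl = refl
  memᵇ-true {x} {y ∷ ys} (there x∈) rewrite memᵇ-true x∈ = ∨-zeroʳ _

  memᵇ-false : ∀ {x : Fin n} {ys} → x ∉ ys → memᵇ x ys ≡ false
  memᵇ-false {x} {[]} _ = refl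
  memᵇ-false {x} {y ∷ ys} x∉ rewrite ⌊⌋-false (x ≟F y) (x∉ ∘ here) = memᵇ-false (x∉ ∘ there)

  memᵇ-∈ : ∀ {x : Fin n} ys → memᵇ x ys ≡ true → x ∈ ys
  memᵇ-∈ {x} (y ∷ ys) mem with x ≟F y
  ... | yes refl = here refl
  ... | no _ = there (memᵇ-∈ ys mem)

  common : List (Fin n) → List (Fin n) → List (Fin n)
  common xs ys = filterᵇ (λ x → memᵇ x ys) xs

  common-none : ∀ xs ys → (∀ {x} → x ∈ xs → x ∉ ys) → common xs ys ≡ []
  common-none xs ys disjoint =
    filter-none (T? ∘ λ x → memᵇ x ys) (All.tabulate λ x∈ → subst T (memᵇ-false (disjoint x∈)))

  common-two : ∀ ys pre u v suf → (∀ {x} → x ∈ pre → x ∉ ys) → (∀ {x} → x ∈ suf → x ∉ ys) →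
               u ∈ ys → v ∈ ys → common (pre ++ u ∷ v ∷ suf) ys ≡ u ∷ v ∷ []
  common-two ys pre u v suf pre∉ suf∉ u∈ v∈ = begin
    filter P? (pre ++ u ∷ v ∷ suf)          ≡⟨ filter-++ P? pre (u ∷ v ∷ suf) ⟩
    filter P? pre ++ filter P? (u ∷ v ∷ suf) ≡⟨ cong (_++ _) (common-none pre ys pre∉) ⟩
    filter P? (u ∷ v ∷ suf)                  ≡⟨ filter-accept P? (accepted u∈) ⟩
    u ∷ filter P? (v ∷ suf)                  ≡⟨ cong (u ∷_) (filter-accept P? (accepted v∈)) ⟩
    u ∷ v ∷ filter P? suf                    ≡⟨ cong (λ zs → u ∷ v ∷ zs) (common-none suf ys suf∉) ⟩
    u ∷ v ∷ [] ∎
    where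
    open ≡-Reasoning
    P? : ∀ x → Dec (T (memᵇ x ys))
    P? = T? ∘ λ x → memᵇ x ys
    accepted : ∀ {x} → x ∈ ys → T (memᵇ x ys)
    accepted x∈ = subst T (sym (memᵇ-true x∈)) tt

  uses-sym : ∀ (p : List (Fin n)) u w → usesᵇ p u w ≡ usesᵇ p w u
  uses-sym [] u w = refl
  uses-sym (x ∷ []) u w = refl
  uses-sym (x ∷ y ∷ r) u w rewrite uses-sym (y ∷ r) u w =
    ∨-swap (⌊ x ≟F u ⌋ ∧ ⌊ y ≟F w ⌋) (⌊ x ≟F w ⌋ ∧ ⌊ y ≟F u ⌋) (usesᵇ (y ∷ r) w u)
    where
    ∨-swap : ∀ a b c → a ∨ (b ∨ c) ≡ b ∨ (a ∨ c)
    ∨-swap true true c = refl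
    ∨-swap true false c = refl
    ∨-swap false true c = refl
    ∨-swap false false c = refl

  uses-there : ∀ (z : Fin n) t {u w} → Uses t u w → Uses (z ∷ t) u w
  uses-there z (t ∷ ts) {u} {w} uses rewrite uses =
    trans (cong ((⌊ z ≟F u ⌋ ∧ ⌊ t ≟F w ⌋) ∨_) (∨-zeroʳ (⌊ z ≟F w ⌋ ∧ ⌊ t ≟F u ⌋)))
          (∨-zeroʳ (⌊ z ≟F u ⌋ ∧ ⌊ t ≟F w ⌋))

  uses-infix : ∀ pre (x y : Fin n) suf → Uses (pre ++ x ∷ y ∷ suf) x y
  uses-infix [] x y suf rewrite ⌊⌋-true (x ≟F x) refl | ⌊⌋-true (y ≟F y) refl = refl
  uses-infix (z ∷ pre) x y suf = uses-there z (pre ++ x ∷ y ∷ suf) (uses-infix pre x y suf)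

  uses-segment : ∀ pre (w x y z : Fin n) suf →
    let p = pre ++ w ∷ x ∷ y ∷ z ∷ suf in Uses p w x × Uses p x y × Uses p y z
  uses-segment pre w x y z suf =
    uses-infix pre w x (y ∷ z ∷ suf) ,
    subst (λ p → Uses p x y) (++-assoc pre (w ∷ []) _) (uses-infix (pre ++ w ∷ []) x y (z ∷ suf)) ,
    subst (λ p → Uses p y z) (++-assoc pre (w ∷ x ∷ []) _) (uses-infix (pre ++ w ∷ x ∷ []) y z suf)

  endpoints-shape : ∀ (x : Fin n) mid y → endpoints (x ∷ mid ++ y ∷ []) ≡ x ∷ y ∷ []
  endpoints-shape x mid y rewrite unfold-reverse x (mid ++ y ∷ []) | reverse-++ mid (y ∷ []) = refl

open Reflection

module InstanceFacts (I : Instance) where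
  open Instance I

  private
    edgeᵇ : Fin n × Fin n → Bool
    edgeᵇ e = ⌊ proj₁ e F.<? proj₂ e ⌋ ∧ memᵇ (proj₂ e) (rot (proj₁ e))

  edge∈ : ∀ {u w} → u F.< w → w ∈ rot u → (u , w) ∈ edges I
  edge∈ {u} {w} u<w w∈ = ∈-filter⁺ (T? ∘ edgeᵇ) (∈-cartesianProduct⁺ (∈-allFin u) (∈-allFin w))
    (subst T (sym (cong₂ _∧_ (⌊⌋-true (u F.<? w) u<w) (memᵇ-true w∈))) tt)

  edges-unique : Unique (edges I)
  edges-unique =
    Uniqueₚ.filter⁺ (T? ∘ edgeᵇ) (Uniqueₚ.cartesianProduct⁺ (Uniqueₚ.allFin⁺ n) (Uniqueₚ.allFin⁺ n))

  -- every edge (u , w) is an entry of the rotation at u; hence a graph of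
  -- maximum degree d has at most d · n edges
  edges-≤ : ∀ d → (∀ v → length (rot v) ≤ d) → length (edges I) ≤ d * n
  edges-≤ d deg≤ = begin
    length (edges I)                      ≤⟨ unique-⊆-length (≡-dec _≟F_ _≟F_) _ darts edges-unique edge⇒dart ⟩
    length darts                          ≡⟨ length-concatMap dartsAt (allFin n) ⟩
    sum (map (length ∘ dartsAt) (allFin n)) ≤⟨ sum-≤ (length ∘ dartsAt) d (allFin n) dartsAt-≤ ⟩
    d * length (allFin n)                 ≡⟨ cong (d *_) (length-tabulate id) ⟩
    d * n ∎
    where
    open ℕ.≤-Reasoning
    dartsAt : Fin n → List (Fin n × Fin n)
    dartsAt u = map (u ,_) (rot u)
    darts : List (Fin n × Fin n)
    darts = concatMap dartsAt (allFin n)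
    dartsAt-≤ : ∀ u → length (dartsAt u) ≤ d
    dartsAt-≤ u = subst (_≤ d) (sym (length-map (u ,_) (rot u))) (deg≤ u)
    edge⇒dart : ∀ {e} → e ∈ edges I → e ∈ darts
    edge⇒dart {u , w} e∈ with ∈-filter⁻ (T? ∘ edgeᵇ) {xs = cartesianProduct (allFin n) (allFin n)} e∈
    ... | _ , isEdge =
      ∈-concatMap⁺ dartsAt (Any.map (λ { refl → ∈-map⁺ (u ,_) (memᵇ-∈ (rot u) w∈rot) }) (∈-allFin u))
      where
      w∈rot : memᵇ w (rot u) ≡ true
      w∈rot = Equivalence.to T-≡ (proj₂ (Equivalence.to T-∧ isEdge))

  shared-edge∈E′ : ∀ {u w i j} → (u , w) ∈ edges I → i ≢ j → Uses (line i) u w → Uses (line j) u w →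
                   (u , w) ∈ edges′ I
  shared-edge∈E′ {u} {w} {i} {j} e∈ i≢j uses-i uses-j =
    ∈-filter⁺ (T? ∘ λ e → 2 ≤ᵇ length (linesOn I (proj₁ e) (proj₂ e))) e∈ (ℕ.≤⇒≤ᵇ two-lines)
    where
    on : ∀ {x} → Uses (line x) u w → x ∈ linesOn I u w
    on {x} uses = ∈-filter⁺ (T? ∘ λ y → usesᵇ (line y) u w) (∈-allFin x) (subst T (sym uses) tt)
    two-lines : 2 ≤ length (linesOn I u w)
    two-lines = two-distinct (on uses-i) (on uses-j) i≢j

  -- adjacent vertices are distinct, so one of them is the smaller
  adjacent-> : ∀ {u w} → w ∈ rot u → ¬ (u F.< w) → w F.< u
  adjacent-> {u} {w} w∈ u≮w with ℕ.<-cmp (toℕ w) (toℕ u)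
  ... | tri< w<u _ _ = w<u
  ... | tri≈ _ w≡u _ = ⊥-elim (rot-noloop u (subst (_∈ rot u) (toℕ-injective w≡u) w∈))
  ... | tri> _ _ u<w = ⊥-elim (u≮w u<w)

  module _ (S : Solution I) where

    outOrder-< : ∀ {u w} → u F.< w → outOrder I S u w ≡ firstL (S u w)
    outOrder-< {u} {w} u<w =
      cong (λ c → if c then firstL (S u w) else reverse (lastL (S w u))) (⌊⌋-true (u F.<? w) u<w)

    outOrder-> : ∀ {u w} → ¬ (u F.< w) → outOrder I S u w ≡ reverse (lastL (S w u))
    outOrder-> {u} {w} u≮w =
      cong (λ c → if c then firstL (S u w) else reverse (lastL (S w u))) (⌊⌋-false (u F.<? w) u≮w)

    unbroken-edge : ∀ {u w Z} → u F.< w → S u w ≡ Z ∷ [] →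
                    outOrder I S u w ≡ Z × outOrder I S w u ≡ reverse Z
    unbroken-edge u<w one-order =
      trans (outOrder-< u<w) (cong firstL one-order) ,
      trans (outOrder-> (ℕ.<-asym u<w)) (cong (reverse ∘ lastL) one-order)

    module _ (valid : ValidSolution I S) where

      on-outOrder : ∀ {i u w} → w ∈ rot u → Uses (line i) u w → i ∈ outOrder I S u w
      on-outOrder {i} {u} {w} w∈ uses with u F.<? w
      ... | yes u<w with valid u w (edge∈ u<w w∈)
      ...   | nonempty , orderings , _ = proj₂ (proj₂ (first (S u w) nonempty orderings) i) uses
        where
        first : ∀ πs → πs ≢ [] → All (IsOrderingOf I u w) πs → IsOrderingOf I u w (firstL πs)
        first [] nonempty _ = ⊥-elim (nonempty refl)
        first (π ∷ _) _ (π-ok ∷ _) = π-ok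
      on-outOrder {i} {u} {w} w∈ uses | no u≮w with valid w u (edge∈ (adjacent-> w∈ u≮w) (rot-sym u w w∈))
      ...   | nonempty , orderings , _ =
        Anyₚ.reverse⁺ (proj₂ (proj₂ (last (S w u) nonempty orderings) i) (trans (uses-sym (line i) w u) uses))
        where
        last : ∀ πs → πs ≢ [] → All (IsOrderingOf I w u) πs → IsOrderingOf I w u (lastL πs)
        last [] nonempty _ = ⊥-elim (nonempty refl)
        last (π ∷ []) _ (π-ok ∷ []) = π-ok
        last (_ ∷ π′ ∷ πs) _ (_ ∷ rest) = last (π′ ∷ πs) (λ ()) rest

    no-interleaving : ∀ {v i j a₁ a₂ b₁ b₂} → ConsistentAt I S v → i ≢ j → SharesEdge I i j →
      Pos (ports I S v) a₁ i → Pos (ports I S v) a₂ j → Pos (ports I S v) b₁ i → Pos (ports I S v) b₂ j →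
      a₁ < a₂ → a₂ < b₁ → b₁ < b₂ → ⊥
    no-interleaving consistent i≢j shared pa₁ pa₂ pb₁ pb₂ a₁<a₂ a₂<b₁ b₁<b₂
      with Pos⇒lookup pa₁ | Pos⇒lookup pa₂ | Pos⇒lookup pb₁ | Pos⇒lookup pb₂
    ... | fa₁ , ia₁ , refl | fa₂ , ja₂ , refl | fb₁ , ib₁ , refl | fb₂ , jb₂ , refl =
      consistent _ _ i≢j shared fa₁ fb₁ fa₂ fb₂ ia₁ ib₁ ja₂ jb₂ (a₁<a₂ , a₂<b₁ , b₁<b₂)

  -- Let {p , q} be an edge with rotations
  -- rot p = l , t , q  and  rot q = p , r , b.  A line i running l p q r and
  -- a line j running t p q b enter p in the order i , j and leave q in the
  -- order i , j (clockwise), so they must swap on {p , q}: every consistent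
  -- solution has a block crossing on that edge.
  forced-crossing : ∀ (S : Solution I) → Consistent I S → ∀ {i j p q l t r b} → i ≢ j → p F.< q →
    rot p ≡ l ∷ t ∷ q ∷ [] → rot q ≡ p ∷ r ∷ b ∷ [] →
    Uses (line i) l p → Uses (line i) p q → Uses (line i) q r →
    Uses (line j) t p → Uses (line j) p q → Uses (line j) q b →
    1 ≤ crossingsOn I S p q
  forced-crossing S (valid , consistent) {i} {j} {p} {q} {l} {t} {r} {b} i≢j p<q rot-p rot-q
                  i-lp i-pq i-qr j-tp j-pq j-qb
    = at-least-two-orders (S p q) refl
    where
    O : Fin n → Fin n → List (Fin k)
    O = outOrder I S

    q∈rot-p : q ∈ rot p
    q∈rot-p = subst (q ∈_) (sym rot-p) (there (there (here refl)))

    in-rotation : ∀ {v w xs} → rot v ≡ xs → w ∈ xs → w ∈ rot v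
    in-rotation rot≡ w∈ = subst (_ ∈_) (sym rot≡) w∈

    i∈pl : i ∈ O p l
    i∈pl = on-outOrder S valid (in-rotation rot-p (here refl)) (trans (uses-sym (line i) p l) i-lp)
    j∈pt : j ∈ O p t
    j∈pt = on-outOrder S valid (in-rotation rot-p (there (here refl))) (trans (uses-sym (line j) p t) j-tp)
    i∈qr : i ∈ O q r
    i∈qr = on-outOrder S valid (in-rotation rot-q (there (here refl))) i-qr
    j∈qb : j ∈ O q b
    j∈qb = on-outOrder S valid (in-rotation rot-q (there (there (here refl)))) j-qb

    shared : SharesEdge I i j
    shared = p , q , i-pq , j-pq

    ports-p : ports I S p ≡ O p l ++ O p t ++ O p q ++ []
    ports-p = cong (concatMap (O p)) rot-p

    ports-q : ports I S q ≡ O q p ++ O q r ++ O q b ++ []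
    ports-q = cong (concatMap (O q)) rot-q

    -- if i precedes j on the edge at p, then around p we see i j i j
    i-before-j-at-p : ∀ {x y} → Pos (O p q) x i → Pos (O p q) y j → x < y → ⊥
    i-before-j-at-p i-at j-at x<y with ∈⇒Pos i∈pl | ∈⇒Pos j∈pt
    ... | _ , i-at-l | _ , j-at-t =
      no-interleaving S (consistent p) i≢j shared
        (on-ports (Pos-++ˡ _ i-at-l))
        (on-ports (Pos-++ʳ (O p l) (Pos-++ˡ _ j-at-t)))
        (on-ports (Pos-++ʳ (O p l) (Pos-++ʳ (O p t) (Pos-++ˡ [] i-at))))
        (on-ports (Pos-++ʳ (O p l) (Pos-++ʳ (O p t) (Pos-++ˡ [] j-at))))
        (ℕ.<-≤-trans (Pos-< i-at-l) (ℕ.m≤m+n _ _))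
        (ℕ.+-monoʳ-< (length (O p l)) (ℕ.<-≤-trans (Pos-< j-at-t) (ℕ.m≤m+n _ _)))
        (ℕ.+-monoʳ-< (length (O p l)) (ℕ.+-monoʳ-< (length (O p t)) x<y))
      where
      on-ports : ∀ {z x} → Pos (O p l ++ O p t ++ O p q ++ []) x z → Pos (ports I S p) x z
      on-ports = subst (λ ps → Pos ps _ _) (sym ports-p)

    -- if i precedes j on the edge at q, then around q we see i j i j
    i-before-j-at-q : ∀ {x y} → Pos (O q p) x i → Pos (O q p) y j → x < y → ⊥
    i-before-j-at-q i-at j-at x<y with ∈⇒Pos i∈qr | ∈⇒Pos j∈qb
    ... | _ , i-at-r | _ , j-at-b =
      no-interleaving S (consistent q) i≢j shared
        (on-ports (Pos-++ˡ _ i-at))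
        (on-ports (Pos-++ˡ _ j-at))
        (on-ports (Pos-++ʳ (O q p) (Pos-++ˡ _ i-at-r)))
        (on-ports (Pos-++ʳ (O q p) (Pos-++ʳ (O q r) (Pos-++ˡ [] j-at-b))))
        x<y
        (ℕ.<-≤-trans (Pos-< j-at) (ℕ.m≤m+n _ _))
        (ℕ.+-monoʳ-< (length (O q p)) (ℕ.<-≤-trans (Pos-< i-at-r) (ℕ.m≤m+n _ _)))
      where
      on-ports : ∀ {z x} → Pos (O q p ++ O q r ++ O q b ++ []) x z → Pos (ports I S q) x z
      on-ports = subst (λ ps → Pos ps _ _) (sym ports-q)

    -- with a single order Z on the edge, i and j take distinct positions in
    -- Z, and either order of them produces an interleaving
    single-order : ∀ Z → O p q ≡ Z → O q p ≡ reverse Z → ⊥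
    single-order Z O-pq O-qp
      with ∈⇒Pos (subst (i ∈_) O-pq (on-outOrder S valid q∈rot-p i-pq))
         | ∈⇒Pos (subst (j ∈_) O-pq (on-outOrder S valid q∈rot-p j-pq))
    ... | x , i-at | y , j-at with ℕ.<-cmp x y
    ...   | tri< x<y _ _ = i-before-j-at-p (at-p i-at) (at-p j-at) x<y
      where
      at-p : ∀ {z w} → Pos Z z w → Pos (O p q) z w
      at-p = subst (λ zs → Pos zs _ _) (sym O-pq)
    ...   | tri≈ _ refl _ = i≢j (Pos-functional i-at j-at)
    ...   | tri> _ _ y<x =
      i-before-j-at-q (at-q (Pos-reverse i-at)) (at-q (Pos-reverse j-at)) (ℕ.∸-monoʳ-< (s≤s y<x) (Pos-< i-at))
      where
      at-q : ∀ {z w} → Pos (reverse Z) z w → Pos (O q p) z w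
      at-q = subst (λ zs → Pos zs _ _) (sym O-qp)

    at-least-two-orders : ∀ πs → S p q ≡ πs → 1 ≤ length πs ∸ 1
    at-least-two-orders [] no-orders = ⊥-elim (proj₁ (valid p q (edge∈ p<q q∈rot-p)) no-orders)
    at-least-two-orders (Z ∷ []) one-order = ⊥-elim (uncurry (single-order Z) (unbroken-edge S p<q one-order))
    at-least-two-orders (_ ∷ _ ∷ _) _ = s≤s z≤n

prev : ∀ {m′} → Fin (suc m′) → Maybe (Fin (suc m′))
prev zero = nothing
prev (suc x) = just (inject₁ x)

next : ∀ {m′} → Fin (suc m′) → Maybe (Fin (suc m′))
next {zero} zero = nothing
next {suc m′} zero = just (suc zero)
next {suc m′} (suc x) = Maybe.map suc (next x)

prev-nothing : ∀ {m′} (b : Fin (suc m′)) → prev b ≡ nothing → b ≡ zero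
prev-nothing zero _ = refl

next-last : ∀ m′ → next (fromℕ m′) ≡ nothing
next-last zero = refl
next-last (suc m′) rewrite next-last m′ = refl

next-nothing : ∀ {m′} (b : Fin (suc m′)) → next b ≡ nothing → b ≡ fromℕ m′
next-nothing {zero} zero _ = refl
next-nothing {suc m′} (suc x) _ with next x in next-x
... | nothing = cong suc (next-nothing x next-x)

next⇒prev : ∀ {m′} (b c : Fin (suc m′)) → next b ≡ just c → prev c ≡ just b
next⇒prev {suc m′} zero .(suc zero) refl = refl
next⇒prev {suc m′} (suc x) c next-b with next x in next-x
next⇒prev {suc m′} (suc x) .(suc c′) refl | just c′ with next⇒prev x c′ next-x
next⇒prev {suc m′} (suc .(inject₁ c″)) .(suc (suc c″)) refl | just (suc c″) | refl = refl

next-inject₁ : ∀ {m′} (x : Fin (suc m′)) → next {suc m′} (inject₁ x) ≡ just (suc x)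
next-inject₁ {m′} zero = refl
next-inject₁ {suc m′} (suc x) rewrite next-inject₁ x = refl

prev⇒next : ∀ {m′} (b c : Fin (suc m′)) → prev c ≡ just b → next b ≡ just c
prev⇒next {suc m′} .(inject₁ x) (suc x) refl = next-inject₁ x

prev-irrefl : ∀ {m′} (b : Fin (suc m′)) → prev b ≢ just b
prev-irrefl (suc x) prev≡ = ℕ.1+n≢n (sym (trans (sym (toℕ-inject₁ x)) (cong toℕ (just-injective prev≡))))

next-irrefl : ∀ {m′} (b : Fin (suc m′)) → next b ≢ just b
next-irrefl b next-b = prev-irrefl b (next⇒prev b b next-b)

ascending : ∀ m′ → List (Fin (suc m′))
ascending zero = zero ∷ []
ascending (suc m′) = zero ∷ map suc (ascending m′)

ascending-complete : ∀ {m′} (b : Fin (suc m′)) → b ∈ ascending m′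
ascending-complete {zero} zero = here refl
ascending-complete {suc m′} zero = here refl
ascending-complete {suc m′} (suc b) = there (∈-map⁺ suc (ascending-complete b))

ascending-unique : ∀ m′ → Unique (ascending m′)
ascending-unique zero = [] ∷ []
ascending-unique (suc m′) = All.tabulate zero∉ ∷ Uniqueₚ.map⁺ suc-injective (ascending-unique m′)
  where
  zero∉ : ∀ {x} → x ∈ map suc (ascending m′) → zero ≢ x
  zero∉ x∈ with ∈-map⁻ suc x∈
  ... | _ , _ , refl = λ ()

length-ascending : ∀ m′ → length (ascending m′) ≡ suc m′
length-ascending zero = refl
length-ascending (suc m′) = cong suc (trans (length-map suc (ascending m′)) (length-ascending m′))

ascending-starts : ∀ m′ → ∃ λ rest → ascending m′ ≡ zero ∷ rest
ascending-starts zero = [] , refl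
ascending-starts (suc m′) = map suc (ascending m′) , refl

ascending-head : ∀ m′ (b : Fin (suc m′)) ys → ascending m′ ≡ b ∷ ys → b ≡ zero
ascending-head m′ b ys ascending≡ = ∷-injectiveˡ (trans (sym ascending≡) (proj₂ (ascending-starts m′)))

Steps : ∀ {m′} → List (Fin (suc m′)) → Set
Steps [] = ⊤
Steps (x ∷ []) = next x ≡ nothing
Steps (x ∷ y ∷ r) = next x ≡ just y × Steps (y ∷ r)

steps-suc : ∀ {m′} (xs : List (Fin (suc m′))) → Steps xs → Steps (map (suc {suc m′}) xs)
steps-suc [] _ = tt
steps-suc (x ∷ []) last = cong (Maybe.map suc) last
steps-suc (x ∷ y ∷ r) (next-x , steps) = cong (Maybe.map suc) next-x , steps-suc (y ∷ r) steps

ascending-steps : ∀ m′ → Steps (ascending m′)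
ascending-steps zero = refl
ascending-steps (suc zero) = refl , refl
ascending-steps (suc (suc m′)) = refl , steps-suc (ascending (suc m′)) (ascending-steps (suc m′))

steps-middle : ∀ {m′} (xs ys : List (Fin (suc m′))) c b → Steps (xs ++ c ∷ b ∷ ys) → next c ≡ just b
steps-middle [] ys c b (next-c , _) = next-c
steps-middle (x ∷ []) ys c b (_ , steps) = steps-middle [] ys c b steps
steps-middle (x ∷ y ∷ xs) ys c b (_ , steps) = steps-middle (y ∷ xs) ys c b steps

steps-end : ∀ {m′} (xs : List (Fin (suc m′))) b → Steps (xs ++ b ∷ []) → next b ≡ nothing
steps-end [] b last = last
steps-end (x ∷ []) b (_ , last) = last
steps-end (x ∷ y ∷ xs) b (_ , steps) = steps-end (y ∷ xs) b steps

_⊕_ : ∀ {a b} {A B : Set} → Fin a ↔ A → Fin b ↔ B → Fin (a + b) ↔ (A ⊎ B)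
f ⊕ g = (f ⊎-↔ g) ↔-∘ +↔⊎
infixr 4 _⊕_

module Grid (m′ : ℕ) where

  m : ℕ
  m = suc m′

  -- six families of vertices: the two ends NW a b , SE a b of each crossing
  -- edge, and the ends of the rows and columns
  Vertex : Set
  Vertex = (Fin m × Fin m) ⊎ (Fin m × Fin m) ⊎ Fin m ⊎ Fin m ⊎ Fin m ⊎ Fin m

  pattern NW a b = inj₁ (a , b)
  pattern SE a b = inj₂ (inj₁ (a , b))
  pattern west a = inj₂ (inj₂ (inj₁ a))
  pattern east a = inj₂ (inj₂ (inj₂ (inj₁ a)))
  pattern north b = inj₂ (inj₂ (inj₂ (inj₂ (inj₁ b))))
  pattern south b = inj₂ (inj₂ (inj₂ (inj₂ (inj₂ b))))

  n : ℕ
  n = m * m + (m * m + (m + (m + (m + m))))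

  vertices : Fin n ↔ Vertex
  vertices = *↔× ⊕ *↔× ⊕ ↔-id _ ⊕ ↔-id _ ⊕ ↔-id _ ⊕ ↔-id _

  enc : Vertex → Fin n
  enc = Inverse.from vertices

  dec : Fin n → Vertex
  dec = Inverse.to vertices

  dec-enc : ∀ x → dec (enc x) ≡ x
  dec-enc = Inverse.strictlyInverseˡ vertices

  enc-dec : ∀ v → enc (dec v) ≡ v
  enc-dec = Inverse.strictlyInverseʳ vertices

  enc-injective : ∀ {x y} → enc x ≡ enc y → x ≡ y
  enc-injective {x} {y} e = trans (sym (dec-enc x)) (trans (cong dec e) (dec-enc y))

  lastF : Fin m
  lastF = fromℕ m′

  westOf northOf eastOf southOf : Fin m → Fin m → Vertex
  westOf a b = maybe′ (SE a) (west a) (prev b)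
  northOf a b = maybe′ (λ x → SE x b) (north b) (prev a)
  eastOf a b = maybe′ (NW a) (east a) (next b)
  southOf a b = maybe′ (λ x → NW x b) (south b) (next a)

  -- neighbours in clockwise order
  rotV : Vertex → List Vertex
  rotV (NW a b) = westOf a b ∷ northOf a b ∷ SE a b ∷ []
  rotV (SE a b) = NW a b ∷ eastOf a b ∷ southOf a b ∷ []
  rotV (west a) = NW a zero ∷ []
  rotV (east a) = SE a lastF ∷ []
  rotV (north b) = NW zero b ∷ []
  rotV (south b) = SE lastF b ∷ []

  westOf-sym : ∀ a b → NW a b ∈ rotV (westOf a b)
  westOf-sym a b with prev b in prev-b
  ... | nothing rewrite prev-nothing b prev-b = here refl
  ... | just c rewrite prev⇒next c b prev-b = there (here refl)

  northOf-sym : ∀ a b → NW a b ∈ rotV (northOf a b)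
  northOf-sym a b with prev a in prev-a
  ... | nothing rewrite prev-nothing a prev-a = here refl
  ... | just c rewrite prev⇒next c a prev-a = there (there (here refl))

  eastOf-sym : ∀ a b → SE a b ∈ rotV (eastOf a b)
  eastOf-sym a b with next b in next-b
  ... | nothing rewrite next-nothing b next-b = here refl
  ... | just c rewrite next⇒prev b c next-b = here refl

  southOf-sym : ∀ a b → SE a b ∈ rotV (southOf a b)
  southOf-sym a b with next a in next-a
  ... | nothing rewrite next-nothing a next-a = here refl
  ... | just c rewrite next⇒prev a c next-a = there (here refl)

  rotV-sym : ∀ x y → y ∈ rotV x → x ∈ rotV y
  rotV-sym (NW a b) _ (here refl) = westOf-sym a b
  rotV-sym (NW a b) _ (there (here refl)) = northOf-sym a b
  rotV-sym (NW a b) _ (there (there (here refl))) = here refl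
  rotV-sym (SE a b) _ (here refl) = there (there (here refl))
  rotV-sym (SE a b) _ (there (here refl)) = eastOf-sym a b
  rotV-sym (SE a b) _ (there (there (here refl))) = southOf-sym a b
  rotV-sym (west a) _ (here refl) = here refl
  rotV-sym (east a) _ (here refl) rewrite next-last m′ = there (here refl)
  rotV-sym (north b) _ (here refl) = there (here refl)
  rotV-sym (south b) _ (here refl) rewrite next-last m′ = there (there (here refl))

  westOf≢northOf : ∀ a b → westOf a b ≢ northOf a b
  westOf≢northOf a b with prev a | prev b in prev-b
  ... | nothing | nothing = λ ()
  ... | nothing | just _ = λ ()
  ... | just _ | nothing = λ ()
  ... | just _ | just _ = λ { refl → prev-irrefl b prev-b }

  westOf≢SE : ∀ a b → westOf a b ≢ SE a b
  westOf≢SE a b with prev b in prev-b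
  ... | nothing = λ ()
  ... | just _ = λ { refl → prev-irrefl b prev-b }

  northOf≢SE : ∀ a b → northOf a b ≢ SE a b
  northOf≢SE a b with prev a in prev-a
  ... | nothing = λ ()
  ... | just _ = λ { refl → prev-irrefl a prev-a }

  NW≢eastOf : ∀ a b → NW a b ≢ eastOf a b
  NW≢eastOf a b with next b in next-b
  ... | nothing = λ ()
  ... | just _ = λ { refl → next-irrefl b next-b }

  NW≢southOf : ∀ a b → NW a b ≢ southOf a b
  NW≢southOf a b with next a in next-a
  ... | nothing = λ ()
  ... | just _ = λ { refl → next-irrefl a next-a }

  eastOf≢southOf : ∀ a b → eastOf a b ≢ southOf a b
  eastOf≢southOf a b with next a | next b in next-b
  ... | nothing | nothing = λ ()
  ... | nothing | just _ = λ ()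
  ... | just _ | nothing = λ ()
  ... | just _ | just _ = λ { refl → next-irrefl b next-b }

  rotV-unique : ∀ x → Unique (rotV x)
  rotV-unique (NW a b) = (westOf≢northOf a b ∷ westOf≢SE a b ∷ []) ∷ (northOf≢SE a b ∷ []) ∷ [] ∷ []
  rotV-unique (SE a b) = (NW≢eastOf a b ∷ NW≢southOf a b ∷ []) ∷ (eastOf≢southOf a b ∷ []) ∷ [] ∷ []
  rotV-unique (west a) = [] ∷ []
  rotV-unique (east a) = [] ∷ []
  rotV-unique (north b) = [] ∷ []
  rotV-unique (south b) = [] ∷ []

  westOf≢NW : ∀ a b c d → westOf a b ≢ NW c d
  westOf≢NW a b c d with prev b
  ... | nothing = λ ()
  ... | just _ = λ ()

  northOf≢NW : ∀ a b c d → northOf a b ≢ NW c d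
  northOf≢NW a b c d with prev a
  ... | nothing = λ ()
  ... | just _ = λ ()

  eastOf≢SE : ∀ a b c d → eastOf a b ≢ SE c d
  eastOf≢SE a b c d with next b
  ... | nothing = λ ()
  ... | just _ = λ ()

  southOf≢SE : ∀ a b c d → southOf a b ≢ SE c d
  southOf≢SE a b c d with next a
  ... | nothing = λ ()
  ... | just _ = λ ()

  rotV-noloop : ∀ x → x ∉ rotV x
  rotV-noloop (NW a b) (here x≡) = westOf≢NW a b a b (sym x≡)
  rotV-noloop (NW a b) (there (here x≡)) = northOf≢NW a b a b (sym x≡)
  rotV-noloop (SE a b) (there (here x≡)) = eastOf≢SE a b a b (sym x≡)
  rotV-noloop (SE a b) (there (there (here x≡))) = southOf≢SE a b a b (sym x≡)
  rotV-noloop (NW a b) (there (there (here ())))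
  rotV-noloop (SE a b) (here ())
  rotV-noloop (west a) (here ())
  rotV-noloop (east a) (here ())
  rotV-noloop (north b) (here ())
  rotV-noloop (south b) (here ())

  rotV-≤3 : ∀ x → length (rotV x) ≤ 3
  rotV-≤3 (NW a b) = s≤s (s≤s (s≤s z≤n))
  rotV-≤3 (SE a b) = s≤s (s≤s (s≤s z≤n))
  rotV-≤3 (west a) = s≤s z≤n
  rotV-≤3 (east a) = s≤s z≤n
  rotV-≤3 (north b) = s≤s z≤n
  rotV-≤3 (south b) = s≤s z≤n

  rot : Fin n → List (Fin n)
  rot v = map enc (rotV (dec v))

  rot-enc : ∀ x → rot (enc x) ≡ map enc (rotV x)
  rot-enc x = cong (map enc ∘ rotV) (dec-enc x)

  enc-∈-rot : ∀ x {y} → y ∈ rotV x → enc y ∈ rot (enc x)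
  enc-∈-rot x {y} y∈ = subst (enc y ∈_) (sym (rot-enc x)) (∈-map⁺ enc y∈)

  ∈-map-enc : ∀ {y} {xs : List Vertex} → enc y ∈ map enc xs → y ∈ xs
  ∈-map-enc y∈ with ∈-map⁻ enc y∈
  ... | z , z∈ , e = subst (_∈ _) (sym (enc-injective e)) z∈

  rot-unique : ∀ v → Unique (rot v)
  rot-unique v = Uniqueₚ.map⁺ enc-injective (rotV-unique (dec v))

  rot-noloop : ∀ v → v ∉ rot v
  rot-noloop v v∈ with ∈-map⁻ enc v∈
  ... | x , x∈ , v≡ = rotV-noloop (dec v) (subst (_∈ rotV (dec v)) (sym (trans (cong dec v≡) (dec-enc x))) x∈)

  rot-sym : ∀ v w → w ∈ rot v → v ∈ rot w
  rot-sym v w w∈ with ∈-map⁻ enc w∈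
  ... | x , x∈ , refl = subst (_∈ rot (enc x)) (enc-dec v) (enc-∈-rot x (rotV-sym (dec v) x x∈))

  -- A track: the vertex sequence st , cp 0 , cq 0 , cp 1 , cq 1 , … , cp m′ , cq m′ , en.
  -- Rows and columns are the tracks of the appropriate vertices.
  module Track (st en : Vertex) (cp cq : Fin m → Vertex) where

    cells : List (Fin m) → List Vertex
    cells [] = []
    cells (b ∷ bs) = cp b ∷ cq b ∷ cells bs

    track : List Vertex
    track = st ∷ cells (ascending m′) ++ en ∷ []

    cells-++ : ∀ xs b ys → cells (xs ++ b ∷ ys) ≡ cells xs ++ cp b ∷ cq b ∷ cells ys
    cells-++ [] b ys = refl
    cells-++ (x ∷ xs) b ys = cong (λ zs → cp x ∷ cq x ∷ zs) (cells-++ xs b ys)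

    cells-∈ : ∀ {y} bs → y ∈ cells bs → ∃ λ c → c ∈ bs × (y ≡ cp c ⊎ y ≡ cq c)
    cells-∈ (b ∷ bs) (here y≡) = b , here refl , inj₁ y≡
    cells-∈ (b ∷ bs) (there (here y≡)) = b , here refl , inj₂ y≡
    cells-∈ (b ∷ bs) (there (there y∈)) with cells-∈ bs y∈
    ... | c , c∈ , y≡ = c , there c∈ , y≡

    track-∈ : ∀ {y} → y ∈ track → (y ≡ st ⊎ y ≡ en) ⊎ ∃ λ c → (y ≡ cp c ⊎ y ≡ cq c)
    track-∈ (here y≡) = inj₁ (inj₁ y≡)
    track-∈ (there y∈) with ∈-++⁻ (cells (ascending m′)) y∈
    ... | inj₁ y∈cells with cells-∈ (ascending m′) y∈cells
    ...   | c , _ , y≡ = inj₂ (c , y≡)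
    track-∈ (there y∈) | inj₂ (here y≡) = inj₁ (inj₂ y≡)

    record SplitAt (b : Fin m) : Set where
      field
        before after : List (Fin m)
        ascending≡ : ascending m′ ≡ before ++ b ∷ after
        track≡ : track ≡ (st ∷ cells before) ++ cp b ∷ cq b ∷ (cells after ++ en ∷ [])

    split : ∀ b → SplitAt b
    split b with ∈-∃++ (ascending-complete b)
    ... | before , after , ascending≡ = record
      { before = before ; after = after ; ascending≡ = ascending≡
      ; track≡ = cong (st ∷_) (begin
          cells (ascending m′) ++ en ∷ []                       ≡⟨ cong (λ bs → cells bs ++ en ∷ []) ascending≡ ⟩
          cells (before ++ b ∷ after) ++ en ∷ []                ≡⟨ cong (_++ en ∷ []) (cells-++ before b after) ⟩
          (cells before ++ cp b ∷ cq b ∷ cells after) ++ en ∷ [] ≡⟨ ++-assoc (cells before) _ _ ⟩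
          cells before ++ cp b ∷ cq b ∷ cells after ++ en ∷ []   ∎) }
      where open ≡-Reasoning

    traverses-cell : ∀ b → ∃ λ pre → ∃ λ suf → track ≡ pre ++ cp b ∷ cq b ∷ suf
    traverses-cell b = st ∷ cells before , cells after ++ en ∷ [] , track≡
      where open SplitAt (split b)

    before-cell : ∀ b → Vertex
    before-cell b = maybe′ cq st (prev b)

    after-cell : ∀ b → Vertex
    after-cell b = maybe′ cp en (next b)

    private
      ends-with-before-cell : ∀ b before after → ascending m′ ≡ before ++ b ∷ after →
        ∃ λ pre → st ∷ cells before ≡ pre ++ before-cell b ∷ []
      ends-with-before-cell b before after ascending≡ with initLast before
      ... | [] rewrite ascending-head m′ b after ascending≡ = [] , refl
      ... | before′ ∷ʳ′ c
        rewrite next⇒prev c b (steps-middle before′ after c b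
                  (subst Steps (trans ascending≡ (++-assoc before′ (c ∷ []) (b ∷ after))) (ascending-steps m′)))
              | cells-++ before′ c [] =
        st ∷ cells before′ ++ cp c ∷ [] , cong (st ∷_) (sym (++-assoc (cells before′) (cp c ∷ []) (cq c ∷ [])))

      starts-with-after-cell : ∀ b before after → ascending m′ ≡ before ++ b ∷ after →
        ∃ λ suf → cells after ++ en ∷ [] ≡ after-cell b ∷ suf
      starts-with-after-cell b before [] ascending≡
        rewrite steps-end before b (subst Steps ascending≡ (ascending-steps m′)) = [] , refl
      starts-with-after-cell b before (d ∷ after) ascending≡
        rewrite steps-middle before after b d (subst Steps ascending≡ (ascending-steps m′)) =
        cq d ∷ cells after ++ en ∷ [] , refl

    around : ∀ b → ∃ λ pre → ∃ λ suf → track ≡ pre ++ before-cell b ∷ cp b ∷ cq b ∷ after-cell b ∷ suf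
    around b with split b
    ... | record { before = before ; after = after ; ascending≡ = ascending≡ ; track≡ = track≡ }
      with ends-with-before-cell b before after ascending≡ | starts-with-after-cell b before after ascending≡
    ... | pre , pre≡ | suf , suf≡ =
      pre , suf , trans track≡ (trans (cong₂ (λ u v → u ++ cp b ∷ cq b ∷ v) pre≡ suf≡) (++-assoc pre _ _))

    module Simple (cp-injective : ∀ {b c} → cp b ≡ cp c → b ≡ c)
                  (cq-injective : ∀ {b c} → cq b ≡ cq c → b ≡ c)
                  (cp≢cq : ∀ b c → cp b ≢ cq c) (st≢cp : ∀ c → st ≢ cp c) (st≢cq : ∀ c → st ≢ cq c)
                  (en≢cp : ∀ c → en ≢ cp c) (en≢cq : ∀ c → en ≢ cq c) (st≢en : st ≢ en) where

      cells-∉ : ∀ {bs b y} → b ∉ bs → y ∈ cells bs → y ≢ cp b × y ≢ cq b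
      cells-∉ {bs} b∉ y∈ with cells-∈ bs y∈
      ... | c , c∈ , inj₁ refl = (λ e → b∉ (subst (_∈ bs) (cp-injective e) c∈)) , cp≢cq c _
      ... | c , c∈ , inj₂ refl = (λ e → cp≢cq _ c (sym e)) , (λ e → b∉ (subst (_∈ bs) (cq-injective e) c∈))

      cells-unique : ∀ bs → Unique bs → Unique (cells bs)
      cells-unique [] _ = []
      cells-unique (b ∷ bs) (b∉ ∷ u) =
        (cp≢cq b b ∷ All.tabulate (λ y∈ e → proj₁ (cells-∉ (b∉bs b∉) y∈) (sym e)))
        ∷ All.tabulate (λ y∈ e → proj₂ (cells-∉ (b∉bs b∉) y∈) (sym e))
        ∷ cells-unique bs u
        where
        b∉bs : ∀ {bs} → All (b ≢_) bs → b ∉ bs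
        b∉bs b∉ b∈ = All.lookup b∉ b∈ refl

      ends-∉ : ∀ {e y} bs → (∀ c → e ≢ cp c) → (∀ c → e ≢ cq c) → y ∈ cells bs → e ≢ y
      ends-∉ bs e≢cp e≢cq y∈ with cells-∈ bs y∈
      ... | c , _ , inj₁ refl = e≢cp c
      ... | c , _ , inj₂ refl = e≢cq c

      track-unique : Unique track
      track-unique =
        All.tabulate st∉ ∷ Uniqueₚ.++⁺ (cells-unique (ascending m′) (ascending-unique m′)) ([] ∷ [])
                                       (λ { (y∈ , here refl) → ends-∉ (ascending m′) en≢cp en≢cq y∈ refl })
        where
        st∉ : ∀ {y} → y ∈ cells (ascending m′) ++ en ∷ [] → st ≢ y
        st∉ y∈ with ∈-++⁻ (cells (ascending m′)) y∈
        ... | inj₁ y∈cells = ends-∉ (ascending m′) st≢cp st≢cq y∈cells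
        ... | inj₂ (here refl) = st≢en

    module Walk (st~cp₀ : enc (cp zero) ∈ rot (enc st)) (cp~cq : ∀ b → enc (cq b) ∈ rot (enc (cp b)))
                (cq~cp : ∀ b c → next b ≡ just c → enc (cp c) ∈ rot (enc (cq b)))
                (cq~en : ∀ b → next b ≡ nothing → enc en ∈ rot (enc (cq b))) where

      cells-path : ∀ b bs → Steps (b ∷ bs) →
                   Consecutive (λ x y → y ∈ rot x) (map enc (cp b ∷ cq b ∷ cells bs ++ en ∷ []))
      cells-path b [] last = cons _ _ _ (cp~cq b) (cons _ _ _ (cq~en b last) (one (enc en)))
      cells-path b (c ∷ bs) (next-b , steps) = cons _ _ _ (cp~cq b) (cons _ _ _ (cq~cp b c next-b) (cells-path c bs steps))

      track-path : Consecutive (λ x y → y ∈ rot x) (map enc track)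
      track-path with ascending m′ | ascending-steps m′ | ascending-starts m′
      ... | .(zero ∷ rest) | steps | rest , refl = cons _ _ _ st~cp₀ (cells-path zero rest steps)

  module Row (a : Fin m) = Track (west a) (east a) (NW a) (SE a)
  module Col (b : Fin m) = Track (north b) (south b) (λ x → NW x b) (λ x → SE x b)

  -- lines are indexed by Fin (m + m): first the rows, then the columns
  Kind : Set
  Kind = Fin m ⊎ Fin m

  trackOf : Kind → List Vertex
  trackOf (inj₁ a) = Row.track a
  trackOf (inj₂ b) = Col.track b

  k : ℕ
  k = m + m

  kind : Fin k → Kind
  kind = F.splitAt m

  kind-injective : ∀ {i j} → kind i ≡ kind j → i ≡ j
  kind-injective {i} {j} e = trans (sym (join-splitAt m m i)) (trans (cong (F.join m m) e) (join-splitAt m m j))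

  line : Fin k → List (Fin n)
  line i = map enc (trackOf (kind i))

  rowOf colOf : Vertex → Maybe (Fin m)
  rowOf (NW a _) = just a
  rowOf (SE a _) = just a
  rowOf (west a) = just a
  rowOf (east a) = just a
  rowOf (north _) = nothing
  rowOf (south _) = nothing
  colOf (NW _ b) = just b
  colOf (SE _ b) = just b
  colOf (west _) = nothing
  colOf (east _) = nothing
  colOf (north b) = just b
  colOf (south b) = just b

  on-row : ∀ {a y} → y ∈ Row.track a → rowOf y ≡ just a
  on-row {a} y∈ with Row.track-∈ a y∈
  ... | inj₁ (inj₁ refl) = refl
  ... | inj₁ (inj₂ refl) = refl
  ... | inj₂ (_ , inj₁ refl) = refl
  ... | inj₂ (_ , inj₂ refl) = refl

  on-col : ∀ {b y} → y ∈ Col.track b → colOf y ≡ just b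
  on-col {b} y∈ with Col.track-∈ b y∈
  ... | inj₁ (inj₁ refl) = refl
  ... | inj₁ (inj₂ refl) = refl
  ... | inj₂ (_ , inj₁ refl) = refl
  ... | inj₂ (_ , inj₂ refl) = refl

  on-row-and-col : ∀ {a b} y → rowOf y ≡ just a → colOf y ≡ just b → y ≡ NW a b ⊎ y ≡ SE a b
  on-row-and-col (NW _ _) refl refl = inj₁ refl
  on-row-and-col (SE _ _) refl refl = inj₂ refl
  on-row-and-col (west _) _ ()
  on-row-and-col (east _) _ ()
  on-row-and-col (north _) () _
  on-row-and-col (south _) () _

  endOf : Vertex → Maybe Kind
  endOf (west a) = just (inj₁ a)
  endOf (east a) = just (inj₁ a)
  endOf (north b) = just (inj₂ b)
  endOf (south b) = just (inj₂ b)
  endOf _ = nothing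

  start finish : Kind → Vertex
  start (inj₁ a) = west a
  start (inj₂ b) = north b
  finish (inj₁ a) = east a
  finish (inj₂ b) = south b

  track-shape : ∀ s → ∃ λ mid → trackOf s ≡ start s ∷ mid ++ finish s ∷ []
  track-shape (inj₁ a) = _ , refl
  track-shape (inj₂ b) = _ , refl

  line-shape : ∀ i → ∃ λ mid → line i ≡ enc (start (kind i)) ∷ mid ++ enc (finish (kind i)) ∷ []
  line-shape i with track-shape (kind i)
  ... | mid , track≡ = map enc mid , trans (cong (map enc) track≡) (cong (_ ∷_) (map-++ enc mid _))

  line-length : ∀ i → 2 ≤ length (line i)
  line-length i with line-shape i
  ... | mid , line≡ rewrite line≡ = long mid
    where
    long : ∀ mid → 2 ≤ length (enc (start (kind i)) ∷ mid ++ enc (finish (kind i)) ∷ [])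
    long [] = s≤s (s≤s z≤n)
    long (_ ∷ _) = s≤s (s≤s z≤n)

  line-endpoints : ∀ i → endpoints (line i) ≡ enc (start (kind i)) ∷ enc (finish (kind i)) ∷ []
  line-endpoints i with line-shape i
  ... | mid , line≡ rewrite line≡ = endpoints-shape _ mid _

  degree : ∀ x → length (rot (enc x)) ≡ length (rotV x)
  degree x = trans (cong length (rot-enc x)) (length-map enc (rotV x))

  line-ends : ∀ i → All (λ v → length (rot v) ≡ 1) (endpoints (line i))
  line-ends i rewrite line-endpoints i = ends-degree (kind i)
    where
    ends-degree : ∀ s → All (λ v → length (rot v) ≡ 1) (enc (start s) ∷ enc (finish s) ∷ [])
    ends-degree (inj₁ a) = degree (west a) ∷ degree (east a) ∷ []
    ends-degree (inj₂ b) = degree (north b) ∷ degree (south b) ∷ []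

  start-end : ∀ s → endOf (start s) ≡ just s
  start-end (inj₁ a) = refl
  start-end (inj₂ b) = refl

  finish-end : ∀ s → endOf (finish s) ≡ just s
  finish-end (inj₁ a) = refl
  finish-end (inj₂ b) = refl

  endpoint-kind : ∀ i {v} → v ∈ endpoints (line i) → endOf (dec v) ≡ just (kind i)
  endpoint-kind i v∈ with subst (_ ∈_) (line-endpoints i) v∈
  ... | here refl = trans (cong endOf (dec-enc _)) (start-end (kind i))
  ... | there (here refl) = trans (cong endOf (dec-enc _)) (finish-end (kind i))

  lines-disjoint-ends : ∀ i j → i ≢ j → ∀ v → v ∈ endpoints (line i) → v ∉ endpoints (line j)
  lines-disjoint-ends i j i≢j v v∈i v∈j =
    i≢j (kind-injective (just-injective (trans (sym (endpoint-kind i v∈i)) (endpoint-kind j v∈j))))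

  Intersection : List (Fin n) → List (Fin n) → Set
  Intersection L₁ L₂ = let c = common L₁ L₂ in Infix c L₁ × (Infix c L₂ ⊎ Infix (reverse c) L₂)

  disjoint-intersection : ∀ t₁ t₂ → (∀ {y} → y ∈ t₁ → y ∉ t₂) →
                          Intersection (map enc t₁) (map enc t₂)
  disjoint-intersection t₁ t₂ disjoint = intersection
    where
    no-common : ∀ {x} → x ∈ map enc t₁ → x ∉ map enc t₂
    no-common x∈₁ x∈₂ with ∈-map⁻ enc x∈₁
    ... | y , y∈ , refl = disjoint y∈ (∈-map-enc x∈₂)
    intersection : Intersection (map enc t₁) (map enc t₂)
    intersection rewrite common-none (map enc t₁) (map enc t₂) no-common = ([] , _ , refl) , inj₁ ([] , _ , refl)

  Traverses : List Vertex → Vertex → Vertex → Set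
  Traverses t u v = ∃ λ pre → ∃ λ suf → t ≡ pre ++ u ∷ v ∷ suf

  edge-intersection : ∀ {t₁ t₂ u v} → Traverses t₁ u v → Traverses t₂ u v → Unique t₁ →
    (∀ {y} → y ∈ t₁ → y ∈ t₂ → y ≡ u ⊎ y ≡ v) → Intersection (map enc t₁) (map enc t₂)
  edge-intersection {u = u} {v} (pre₁ , suf₁ , refl) (pre₂ , suf₂ , refl) unique meet =
    subst₂ Intersection (sym (map-++ enc pre₁ (u ∷ v ∷ suf₁))) (sym (map-++ enc pre₂ (u ∷ v ∷ suf₂)))
      intersection
    where
    L₂ : List (Fin n)
    L₂ = map enc pre₂ ++ enc u ∷ enc v ∷ map enc suf₂
    outside : ∀ {x} → x ∈ map enc pre₁ ++ map enc suf₁ → x ∉ L₂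
    outside x∈₁ x∈₂ with ∈-map⁻ enc (subst (_ ∈_) (sym (map-++ enc pre₁ suf₁)) x∈₁)
    ... | y , y∈ , refl with unique-outside pre₁ u v suf₁ unique y∈
                           | meet (∈-insert pre₁ u (v ∷ suf₁) (∈-insert pre₁ v suf₁ y∈))
                                  (∈-map-enc (subst (_ ∈_) (sym (map-++ enc pre₂ (u ∷ v ∷ suf₂))) x∈₂))
    ...   | y≢u , _ | inj₁ y≡u = y≢u y≡u
    ...   | _ , y≢v | inj₂ y≡v = y≢v y≡v
    intersection : Intersection (map enc pre₁ ++ enc u ∷ enc v ∷ map enc suf₁) L₂
    intersection
      rewrite common-two L₂ (map enc pre₁) (enc u) (enc v) (map enc suf₁)
                (λ x∈ → outside (∈-++⁺ˡ x∈)) (λ x∈ → outside (∈-++⁺ʳ (map enc pre₁) x∈))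
                (∈-++⁺ʳ (map enc pre₂) (here refl)) (∈-++⁺ʳ (map enc pre₂) (there (here refl)))
      = (map enc pre₁ , map enc suf₁ , refl) , inj₁ (map enc pre₂ , map enc suf₂ , refl)

  row-unique : ∀ a → Unique (Row.track a)
  row-unique a = Row.Simple.track-unique a (λ { refl → refl }) (λ { refl → refl })
                   (λ _ _ ()) (λ _ ()) (λ _ ()) (λ _ ()) (λ _ ()) (λ ())

  col-unique : ∀ b → Unique (Col.track b)
  col-unique b = Col.Simple.track-unique b (λ { refl → refl }) (λ { refl → refl })
                   (λ _ _ ()) (λ _ ()) (λ _ ()) (λ _ ()) (λ _ ()) (λ ())

  track-unique : ∀ s → Unique (trackOf s)
  track-unique (inj₁ a) = row-unique a
  track-unique (inj₂ b) = col-unique b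

  track-intersection : ∀ s t → s ≢ t → Intersection (map enc (trackOf s)) (map enc (trackOf t))
  track-intersection (inj₁ a) (inj₁ a′) s≢t = disjoint-intersection _ _ λ y∈ y∈′ →
    s≢t (cong inj₁ (just-injective (trans (sym (on-row y∈)) (on-row y∈′))))
  track-intersection (inj₂ b) (inj₂ b′) s≢t = disjoint-intersection _ _ λ y∈ y∈′ →
    s≢t (cong inj₂ (just-injective (trans (sym (on-col y∈)) (on-col y∈′))))
  track-intersection (inj₁ a) (inj₂ b) _ =
    edge-intersection (Row.traverses-cell a b) (Col.traverses-cell b a)
      (row-unique a) (λ y∈r y∈c → on-row-and-col _ (on-row y∈r) (on-col y∈c))
  track-intersection (inj₂ b) (inj₁ a) _ =
    edge-intersection (Col.traverses-cell b a) (Row.traverses-cell a b)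
      (col-unique b) (λ y∈c y∈r → on-row-and-col _ (on-row y∈r) (on-col y∈c))

  row-path : ∀ a → Consecutive (λ x y → y ∈ rot x) (map enc (Row.track a))
  row-path a = Row.Walk.track-path a (enc-∈-rot (west a) (here refl))
    (λ b → enc-∈-rot (NW a b) (there (there (here refl))))
    (λ b c next-b → enc-∈-rot (SE a b) (there (here (cong (maybe′ (NW a) (east a)) (sym next-b)))))
    (λ b next-b → enc-∈-rot (SE a b) (there (here (cong (maybe′ (NW a) (east a)) (sym next-b)))))

  col-path : ∀ b → Consecutive (λ x y → y ∈ rot x) (map enc (Col.track b))
  col-path b = Col.Walk.track-path b (enc-∈-rot (north b) (here refl))
    (λ a → enc-∈-rot (NW a b) (there (there (here refl))))
    (λ a c next-a → enc-∈-rot (SE a b) (there (there (here (cong (maybe′ (λ x → NW x b) (south b)) (sym next-a))))))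
    (λ a next-a → enc-∈-rot (SE a b) (there (there (here (cong (maybe′ (λ x → NW x b) (south b)) (sym next-a))))))

  track-path : ∀ s → Consecutive (λ x y → y ∈ rot x) (map enc (trackOf s))
  track-path (inj₁ a) = row-path a
  track-path (inj₂ b) = col-path b

  grid : Instance
  grid = record
    { n = n ; rot = rot ; k = k ; line = line
    ; rot-unique = rot-unique ; rot-noloop = rot-noloop ; rot-sym = rot-sym
    ; line-len = line-length
    ; line-simple = λ i → Uniqueₚ.map⁺ enc-injective (track-unique (kind i))
    ; line-path = λ i → track-path (kind i)
    ; line-ends = line-ends
    ; line-disj = lines-disjoint-ends
    ; line-inter = λ i j i≢j → track-intersection (kind i) (kind j) (i≢j ∘ kind-injective)
    }

module GridBounds (m′ : ℕ) where
  open Grid m′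
  open InstanceFacts grid

  row col : Fin m → Fin k
  row a = a ↑ˡ m
  col b = m ↑ʳ b

  row≢col : ∀ a b → row a ≢ col b
  row≢col a b row≡col with trans (sym (splitAt-↑ˡ m a m)) (trans (cong kind row≡col) (splitAt-↑ʳ m m b))
  ... | ()

  line-row : ∀ a → line (row a) ≡ map enc (Row.track a)
  line-row a = cong (map enc ∘ trackOf) (splitAt-↑ˡ m a m)

  line-col : ∀ b → line (col b) ≡ map enc (Col.track b)
  line-col b = cong (map enc ∘ trackOf) (splitAt-↑ʳ m m b)

  crossing-edge : Fin m × Fin m → Fin n × Fin n
  crossing-edge (a , b) = enc (NW a b) , enc (SE a b)

  NW<SE : ∀ a b → enc (NW a b) F.< enc (SE a b)
  NW<SE a b = subst₂ _<_ (sym (toℕ-↑ˡ (combine a b) _)) (sym (toℕ-↑ʳ (m * m) (combine a b ↑ˡ _)))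
                (ℕ.<-≤-trans (toℕ<n (combine a b)) (ℕ.m≤m+n (m * m) _))

  Through : List (Fin n) → Vertex → Vertex → Vertex → Vertex → Set
  Through L w x y z = Uses L (enc w) (enc x) × Uses L (enc x) (enc y) × Uses L (enc y) (enc z)

  through : ∀ t {w x y z} → (∃ λ pre → ∃ λ suf → t ≡ pre ++ w ∷ x ∷ y ∷ z ∷ suf) →
            Through (map enc t) w x y z
  through t {w} {x} {y} {z} (pre , suf , refl)
    rewrite map-++ enc pre (w ∷ x ∷ y ∷ z ∷ suf) = uses-segment (map enc pre) _ _ _ _ (map enc suf)

  row-through : ∀ a b → Through (line (row a)) (westOf a b) (NW a b) (SE a b) (eastOf a b)
  row-through a b = subst (λ L → Through L (westOf a b) (NW a b) (SE a b) (eastOf a b)) (sym (line-row a))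
                      (through _ (Row.around a b))

  col-through : ∀ a b → Through (line (col b)) (northOf a b) (NW a b) (SE a b) (southOf a b)
  col-through a b = subst (λ L → Through L (northOf a b) (NW a b) (SE a b) (southOf a b)) (sym (line-col b))
                      (through _ (Col.around b a))

  crossing-forced : ∀ S → Consistent grid S → ∀ a b → 1 ≤ crossingsOn grid S (enc (NW a b)) (enc (SE a b))
  crossing-forced S consistent a b with row-through a b | col-through a b
  ... | r-wp , r-pq , r-qe | c-np , c-pq , c-qs =
    forced-crossing S consistent (row≢col a b) (NW<SE a b) (rot-enc (NW a b)) (rot-enc (SE a b))
      r-wp r-pq r-qe c-np c-pq c-qs

  crossing-edges : List (Fin n × Fin n)
  crossing-edges = map crossing-edge (cartesianProduct (ascending m′) (ascending m′))

  crossing-edge-injective : ∀ {x y} → crossing-edge x ≡ crossing-edge y → x ≡ y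
  crossing-edge-injective {a , b} {a′ , b′} edge≡ with enc-injective {NW a b} {NW a′ b′} (cong proj₁ edge≡)
  ... | refl = refl

  crossing-edges-unique : Unique crossing-edges
  crossing-edges-unique = Uniqueₚ.map⁺ crossing-edge-injective
                            (Uniqueₚ.cartesianProduct⁺ (ascending-unique m′) (ascending-unique m′))

  length-crossing-edges : length crossing-edges ≡ m * m
  length-crossing-edges = begin
    length crossing-edges                         ≡⟨ length-map crossing-edge pairs ⟩
    length pairs                                  ≡⟨ length-cartesianProduct (ascending m′) _ ⟩
    length (ascending m′) * length (ascending m′) ≡⟨ cong₂ _*_ (length-ascending m′) (length-ascending m′) ⟩
    m * m ∎
    where
    open ≡-Reasoning
    pairs : List (Fin m × Fin m)
    pairs = cartesianProduct (ascending m′) (ascending m′)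

  crossing-edge-of : ∀ {e} → e ∈ crossing-edges → ∃ λ a → ∃ λ b → e ≡ crossing-edge (a , b)
  crossing-edge-of e∈ with ∈-map⁻ crossing-edge e∈
  ... | (a , b) , _ , e≡ = a , b , e≡

  crossing-edge∈edges : ∀ {e} → e ∈ crossing-edges → e ∈ edges grid
  crossing-edge∈edges e∈ with crossing-edge-of e∈
  ... | a , b , refl = edge∈ (NW<SE a b) (enc-∈-rot (NW a b) (there (there (here refl))))

  crossing-edge∈E′ : ∀ {e} → e ∈ crossing-edges → e ∈ edges′ grid
  crossing-edge∈E′ e∈ with crossing-edge-of e∈
  ... | a , b , refl = shared-edge∈E′ (crossing-edge∈edges e∈) (row≢col a b)
    (proj₁ (proj₂ (row-through a b))) (proj₁ (proj₂ (col-through a b)))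

  _≟E_ : DecidableEquality (Fin n × Fin n)
  _≟E_ = ≡-dec _≟F_ _≟F_

  total-≥ : ∀ S → Consistent grid S → m * m ≤ total grid S
  total-≥ S consistent = subst (_≤ total grid S) length-crossing-edges
    (count _≟E_ (λ e → crossingsOn grid S (proj₁ e) (proj₂ e)) crossing-edges (edges grid)
           crossing-edges-unique crossing-edge∈edges crossing-at)
    where
    crossing-at : ∀ {e} → e ∈ crossing-edges → 1 ≤ crossingsOn grid S (proj₁ e) (proj₂ e)
    crossing-at e∈ with crossing-edge-of e∈
    ... | a , b , refl = crossing-forced S consistent a b

  E′-≥ : m * m ≤ length (edges′ grid)
  E′-≥ = subst (_≤ length (edges′ grid)) length-crossing-edges
           (unique-⊆-length _≟E_ crossing-edges (edges′ grid) crossing-edges-unique crossing-edge∈E′)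

  E′-≤ : length (edges′ grid) ≤ 18 * (m * m)
  E′-≤ = begin
    length (edges′ grid)                   ≤⟨ length-filter _ (edges grid) ⟩
    length (edges grid)                    ≤⟨ edges-≤ 3 degree-≤3 ⟩
    3 * n                                  ≤⟨ ℕ.*-monoʳ-≤ 3 n≤6m² ⟩
    3 * (6 * (m * m))                      ≡⟨ ℕ.*-assoc 3 6 (m * m) ⟨
    18 * (m * m) ∎
    where
    open ℕ.≤-Reasoning
    degree-≤3 : ∀ v → length (rot v) ≤ 3
    degree-≤3 v = subst (_≤ 3) (sym (length-map enc (rotV (dec v)))) (rotV-≤3 (dec v))
    m≤m² : m ≤ m * m
    m≤m² = ℕ.m≤m*n m m
    six-times : ∀ x → x + (x + (x + (x + (x + x)))) ≡ 6 * x
    six-times x = cong (λ y → x + (x + (x + (x + (x + y))))) (sym (ℕ.+-identityʳ x))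
    n≤6m² : n ≤ 6 * (m * m)
    n≤6m² = ℕ.≤-trans (ℕ.+-monoʳ-≤ (m * m) (ℕ.+-monoʳ-≤ (m * m)
              (ℕ.+-mono-≤ m≤m² (ℕ.+-mono-≤ m≤m² (ℕ.+-mono-≤ m≤m² m≤m²)))))
              (ℕ.≤-reflexive (six-times (m * m)))

  -- the bound of the theorem for the grid, with constant 72:
  -- k² |E′| = 4m² |E′| ≤ 72 m⁴ ≤ 72 t²
  grid-bound : ∀ S → Consistent grid S → k ^ 2 * length (edges′ grid) ≤ 72 * total grid S ^ 2
  grid-bound S consistent = begin
    k ^ 2 * length (edges′ grid)     ≤⟨ ℕ.*-monoʳ-≤ (k ^ 2) E′-≤ ⟩
    (m + m) ^ 2 * (18 * (m * m))    ≡⟨ expand m ⟩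
    72 * ((m * m) * (m * m))        ≤⟨ ℕ.*-monoʳ-≤ 72 (ℕ.*-mono-≤ m²≤t m²≤t) ⟩
    72 * (t * t)                    ≡⟨ cong (λ x → 72 * (t * x)) (ℕ.*-identityʳ t) ⟨
    72 * t ^ 2 ∎
    where
    open ℕ.≤-Reasoning
    t : ℕ
    t = total grid S
    m²≤t : m * m ≤ t
    m²≤t = total-≥ S consistent
    expand : ∀ x → (x + x) ^ 2 * (18 * (x * x)) ≡ 72 * ((x * x) * (x * x))
    expand = solve 1 (λ x → ((x :+ x) :^ 2) :* (con 18 :* (x :* x)) := con 72 :* ((x :* x) :* (x :* x))) refl

theorem9 : Σ ℕ λ C → 0 < C × (∀ (N : ℕ) → Σ Instance λ I → N ≤ length (edges′ I) × (∀ (S : Solution I) → Consistent I S → Instance.k I ^ 2 * length (edges′ I) ≤ C * total I S ^ 2))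
theorem9 = 72 , s≤s z≤n , λ N → Grid.grid N , N≤E′ N , GridBounds.grid-bound N
  where
  N≤E′ : ∀ N → N ≤ length (edges′ (Grid.grid N))
  N≤E′ N = ℕ.≤-trans (ℕ.≤-trans (ℕ.n≤1+n N) (ℕ.m≤m*n (suc N) (suc N))) (GridBounds.E′-≥ N)
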